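{- Let $t\in\mathbb{N}$. (i) If $s(t+1)=s(t)+2$, then $s(t)=s_2(t)$ and $s(t+1)=s_2(t+1)$. (ii) If $s(t)\ne s_2(t)$ or $s(t+1)\ne s_2(t+1)$, then $s(t+1)\ge s(t)+3$. (iii) If $s(t)=s_2(t)$ and $s(t+1)\ne s_2(t+1)$, then $s_2(t+1)\ge s_2(t)+4$.
   Context: All graphs are finite, simple and undirected. $\alpha(G)$ denotes the maximum size of a stable set, $\theta(G)$ the minimum number of cliques partitioning $V(G)$, and $\mathrm{gap}(G)=\theta(G)-\alpha(G)$. $s(t)$ (resp. $s_2(t)$) is the smallest number of vertices of a graph (resp. triangle-free graph) with gap $t$. -}

module Defs where

open import Data.Nat using (ℕ; suc; _+_; _≤_; _<_)
open import Data.Fin using (Fin)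
open import Data.Fin.Subset using (Subset; _∈_; ∣_∣)
open import Data.Bool using (Bool; true; false)
open import Data.Product using (Σ; _×_; ∃; ∃-syntax)
open import Relation.Binary.PropositionalEquality using (_≡_; _≢_)
open import Relation.Nullary using (¬_)

record Graph (n : ℕ) : Set where
  field
    adj   : Fin n → Fin n → Bool
    irrefl : ∀ i → adj i i ≡ false
    sym    : ∀ i j → adj i j ≡ adj j i
open Graph public

Stable : ∀ {n} → Graph n → Subset n → Set
Stable G S = ∀ i j → i ∈ S → j ∈ S → i ≢ j → adj G i j ≡ false

HasStable : ∀ {n} → Graph n → ℕ → Set
HasStable G k = ∃[ S ] (Stable G S × ∣ S ∣ ≡ k)

IsAlpha : ∀ {n} → Graph n → ℕ → Set
IsAlpha G a = HasStable G a × (∀ k → HasStable G k → k ≤ a)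

-- A partition of V(G) into (at most) k cliques, given by a class map:
-- any two distinct vertices in the same class are adjacent.
CliqueCover : ∀ {n} → Graph n → ℕ → Set
CliqueCover {n} G k = Σ (Fin n → Fin k) λ f →
  ∀ i j → f i ≡ f j → i ≢ j → adj G i j ≡ true

IsTheta : ∀ {n} → Graph n → ℕ → Set
IsTheta G c = CliqueCover G c × (∀ k → CliqueCover G k → c ≤ k)

HasGap : ∀ {n} → Graph n → ℕ → Set
HasGap G t = ∃[ a ] ∃[ c ] (IsAlpha G a × IsTheta G c × c ≡ t + a)

TriangleFree : ∀ {n} → Graph n → Set
TriangleFree G = ∀ i j k → ¬ (adj G i j ≡ true × adj G j k ≡ true × adj G i k ≡ true)

IsS : ℕ → ℕ → Set
IsS t m = (Σ (Graph m) λ G → HasGap G t)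
        × (∀ n → n < m → (G : Graph n) → ¬ HasGap G t)

IsS₂ : ℕ → ℕ → Set
IsS₂ t m = (Σ (Graph m) λ G → TriangleFree G × HasGap G t)
         × (∀ n → n < m → (G : Graph n) → TriangleFree G → ¬ HasGap G t)

-- Deleting a clique K from a graph G cannot raise α, and a clique cover of G − K
-- plus the single class K covers G, so gap(G − K) ≥ gap(G) − 1.  Deleting the
-- vertices of a graph one at a time thus never lowers the gap by more than one per
-- step and ends at gap 0 on the empty graph, so a graph with gap ≥ t has an induced
-- subgraph with gap exactly t: s(t) is also the least order of a graph with gap ≥ t.
-- A graph of positive gap has an edge, and deleting it (or a triangle, if there is
-- one) from a graph with gap t + 1 on s(t + 1) vertices leaves gap ≥ t on
-- s(t + 1) − 2 (resp. s(t + 1) − 3) vertices, triangle-free if the graph was.  So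
-- s(t + 1) ≥ s(t) + 2, and equality forces the extremal graph to be triangle-free,
-- which ties s to s₂ at t and t + 1.
module Submission where

open import Defs renaming (sym to adj-sym)
open import Data.Nat using (ℕ; zero; suc; _+_; _∸_; _≤_; _≥_; z≤n; s≤s)
open import Data.Nat.Properties
  using (≤-refl; ≤-trans; ≤-antisym; m≤n⇒m≤1+n; m<1+n⇒m≤n; ≤∧≢⇒<; ≮⇒≥;
         m≤n⇒m<n∨m≡n; +-comm; +-suc; +-monoˡ-≤; +-monoʳ-≤; +-cancelˡ-≤; +-cancelʳ-≤;
         m+n≮n; m∸n+n≡m; m+n≤o⇒n≤o; m+n≤o⇒m≤o∸n; ≤-pred; module ≤-Reasoning)
  renaming (_≟_ to _≟ℕ_)
open import Data.Fin as Fin using (Fin; zero; suc; punchIn; punchOut; inject₁; fromℕ)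
open import Data.Fin.Properties using (any?; all?; punchIn-punchOut; fromℕ≢inject₁; inject₁-injective)
open import Data.Fin.Subset using (Subset; _∈_; ∣_∣; ⊤; outside; inside) renaming (⊥ to ∅)
open import Data.Fin.Subset.Properties using (_∈?_; ∣p∣≤n; ∣⊤∣≡n; ∣⊥∣≡0; ∉⊥; anySubset?)
open import Data.Vec using (_∷_; insertAt; lookup)
open import Data.Vec.Properties using (insertAt-lookup; insertAt-punchIn; []=⇒lookup; lookup⇒[]=)
open import Data.Vec.Functional using () renaming (_∷_ to _◂_)
open import Data.Bool using (true; false)
open import Data.Bool.Properties using (¬-not) renaming (_≟_ to _≟ᵇ_)
open import Data.Product using (Σ; _×_; _,_; ∃; ∃₂)
open import Data.Sum using (_⊎_; inj₁; inj₂)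
open import Data.Empty using (⊥-elim)
open import Function using (_∘_; id)
open import Relation.Unary using (Decidable)
open import Relation.Nullary using (Dec; yes; no; ¬?; contradiction)
open import Relation.Nullary.Decidable using (map′; _→-dec_; _×-dec_)
open import Relation.Binary.PropositionalEquality
  using (_≡_; _≢_; refl; sym; trans; cong; subst; subst₂; module ≡-Reasoning)

private
  variable
    m n k r s t : ℕ

least : (P : ℕ → Set) → Decidable P → ∀ n → P n → Σ ℕ λ k → P k × (∀ j → P j → k ≤ j)
least P P? n pn with P? 0
... | yes p0 = 0 , p0 , λ _ _ → z≤n
least P P? zero    p0 | no ¬p0 = ⊥-elim (¬p0 p0)
least P P? (suc n) pn | no ¬p0 with least (P ∘ suc) (P? ∘ suc) n pn
... | k , pk , k-least = suc k , pk , λ { zero p0 → ⊥-elim (¬p0 p0) ; (suc j) pj → s≤s (k-least j pj) }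

greatest : (P : ℕ → Set) → Decidable P → P 0 → ∀ n → (∀ k → P k → k ≤ n) →
           Σ ℕ λ k → P k × (∀ j → P j → j ≤ k)
greatest P P? p0 zero    bound = 0 , p0 , bound
greatest P P? p0 (suc n) bound with P? (suc n)
... | yes p = suc n , p , bound
... | no ¬p = greatest P P? p0 n λ j pj → m<1+n⇒m≤n (≤∧≢⇒< (bound j pj) λ { refl → ¬p pj })

-- P must respect pointwise equality: a function is rebuilt from its head and
-- tail only up to ≗.
∃-function? : ∀ n (P : (Fin n → Fin k) → Set) →
              (∀ {f g} → (∀ i → f i ≡ g i) → P f → P g) → Decidable P → Dec (∃ P)
∃-function? {k} zero P resp P? = map′ (λ p → empty , p) (λ (f , p) → resp (λ ()) p) (P? empty)
  where
  empty : Fin 0 → Fin k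
  empty ()
∃-function? (suc n) P resp P? =
  map′ (λ (a , f , p) → a ◂ f , p)
       (λ (f , p) → f zero , f ∘ suc , resp (λ { zero → refl ; (suc i) → refl }) p)
       (any? λ a → ∃-function? n (P ∘ (a ◂_)) (λ f≗g → resp λ { zero → refl ; (suc i) → f≗g i })
                                (P? ∘ (a ◂_)))

cliqueCover? : (G : Graph n) → ∀ k → Dec (CliqueCover G k)
cliqueCover? {n} G k = ∃-function? n Covers resp covers?
  where
  Covers : (Fin n → Fin k) → Set
  Covers f = ∀ i j → f i ≡ f j → i ≢ j → adj G i j ≡ true
  resp : ∀ {f g} → (∀ i → f i ≡ g i) → Covers f → Covers g
  resp f≗g covers i j gi≡gj = covers i j (trans (f≗g i) (trans gi≡gj (sym (f≗g j))))
  covers? : Decidable Covers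
  covers? f = all? λ i → all? λ j →
    (f i Fin.≟ f j) →-dec (¬? (i Fin.≟ j) →-dec (adj G i j ≟ᵇ true))

hasStable? : (G : Graph n) → ∀ k → Dec (HasStable G k)
hasStable? G k = anySubset? λ S → stable? S ×-dec (∣ S ∣ ≟ℕ k)
  where
  stable? : Decidable (Stable G)
  stable? S = all? λ i → all? λ j →
    (i ∈? S) →-dec ((j ∈? S) →-dec (¬? (i Fin.≟ j) →-dec (adj G i j ≟ᵇ false)))

α-exists : (G : Graph n) → Σ ℕ (IsAlpha G)
α-exists {n} G = greatest (HasStable G) (hasStable? G) empty n λ { _ (S , _ , refl) → ∣p∣≤n S }
  where
  empty : HasStable G 0
  empty = ∅ , (λ _ _ i∈∅ → contradiction i∈∅ ∉⊥) , ∣⊥∣≡0 n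

discreteCover : (G : Graph n) → CliqueCover G n
discreteCover G = id , λ i j i≡j i≢j → contradiction i≡j i≢j

θ-exists : (G : Graph n) → Σ ℕ (IsTheta G)
θ-exists {n} G = least (CliqueCover G) (cliqueCover? G) n (discreteCover G)

adj⇒≢ : (G : Graph n) {u v : Fin n} → adj G u v ≡ true → u ≢ v
adj⇒≢ G {u} uv refl = contradiction (trans (sym uv) (irrefl G u)) λ ()

positiveGap⇒edge : (G : Graph n) → HasGap G (suc t) → ∃₂ λ u v → adj G u v ≡ true
positiveGap⇒edge {n} {t} G (a , c , (_ , α-max) , (_ , θ-min) , c≡) with any? (λ u → any? λ v → adj G u v ≟ᵇ true)
... | yes (u , v , uv) = u , v , uv
... | no edgeless = contradiction 1+t+a≤a (m+n≮n t a)
  where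
  stable : Stable G ⊤
  stable u v _ _ _ = ¬-not λ uv → edgeless (u , v , uv)
  open ≤-Reasoning
  1+t+a≤a : suc t + a ≤ a
  1+t+a≤a = begin
    suc t + a ≡⟨ c≡ ⟨
    c         ≤⟨ θ-min n (discreteCover G) ⟩
    n         ≤⟨ α-max n (⊤ , stable , ∣⊤∣≡n n) ⟩
    a         ∎

Triangle : Graph n → Fin n → Fin n → Fin n → Set
Triangle G i j k = adj G i j ≡ true × adj G j k ≡ true × adj G i k ≡ true

triangle-or-triangleFree : (G : Graph n) → (∃ λ i → ∃₂ λ j k → Triangle G i j k) ⊎ TriangleFree G
triangle-or-triangleFree G with any? (λ i → any? λ j → any? λ k → triangle? i j k)
  where
  triangle? : ∀ i j k → Dec (Triangle G i j k)
  triangle? i j k = (adj G i j ≟ᵇ true) ×-dec ((adj G j k ≟ᵇ true) ×-dec (adj G i k ≟ᵇ true))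
... | yes triangle = inj₁ triangle
... | no ¬triangle = inj₂ λ i j k ijk → ¬triangle (i , j , k , ijk)

infixl 5 _[_] _─_

_[_] : Graph n → (Fin m → Fin n) → Graph m
G [ ι ] = record
  { adj    = λ i j → adj G (ι i) (ι j)
  ; irrefl = irrefl G ∘ ι
  ; sym    = λ i j → adj-sym G (ι i) (ι j)
  }

_─_ : Graph (suc n) → Fin (suc n) → Graph n
G ─ i = G [ punchIn i ]

triangleFree-[] : (G : Graph n) (ι : Fin m → Fin n) → TriangleFree G → TriangleFree (G [ ι ])
triangleFree-[] G ι triangleFree i j k = triangleFree (ι i) (ι j) (ι k)

∣insertAt-outside∣ : (S : Subset n) (i : Fin (suc n)) → ∣ insertAt S i outside ∣ ≡ ∣ S ∣
∣insertAt-outside∣ S             zero    = refl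
∣insertAt-outside∣ (inside  ∷ S) (suc i) = cong suc (∣insertAt-outside∣ S i)
∣insertAt-outside∣ (outside ∷ S) (suc i) = ∣insertAt-outside∣ S i

∈-insertAt-outside : (S : Subset n) (i : Fin (suc n)) {a : Fin (suc n)} →
                     a ∈ insertAt S i outside → ∃ λ a′ → punchIn i a′ ≡ a × a′ ∈ S
∈-insertAt-outside {n} S i {a} a∈ with i Fin.≟ a
... | yes refl = contradiction (trans (sym (insertAt-lookup S i outside)) ([]=⇒lookup a∈)) λ ()
... | no i≢a = punchOut i≢a , punchIn-punchOut i≢a , lookup⇒[]= _ S a′∈S
  where
  open ≡-Reasoning
  S′ : Subset (suc n)
  S′ = insertAt S i outside
  a′∈S : lookup S (punchOut i≢a) ≡ inside
  a′∈S = begin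
    lookup S (punchOut i≢a)              ≡⟨ insertAt-punchIn S i outside _ ⟨
    lookup S′ (punchIn i (punchOut i≢a)) ≡⟨ cong (lookup S′) (punchIn-punchOut i≢a) ⟩
    lookup S′ a                          ≡⟨ []=⇒lookup a∈ ⟩
    inside                               ∎

hasStable-─ : (G : Graph (suc n)) (i : Fin (suc n)) → HasStable (G ─ i) k → HasStable G k
hasStable-─ G i (S , stable , refl) = insertAt S i outside , stable′ , ∣insertAt-outside∣ S i
  where
  stable′ : Stable G (insertAt S i outside)
  stable′ a b a∈ b∈ a≢b with ∈-insertAt-outside S i a∈ | ∈-insertAt-outside S i b∈
  ... | a′ , refl , a′∈S | b′ , refl , b′∈S = stable a′ b′ a′∈S b′∈S (a≢b ∘ cong (punchIn i))

Missed : (Fin m → Fin n) → Fin n → Set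
Missed ι v = ∀ j → ι j ≢ v

IsClique : Graph n → (Fin n → Set) → Set
IsClique G P = ∀ u v → P u → P v → u ≢ v → adj G u v ≡ true

missed-∘punchIn : (ι : Fin (suc m) → Fin n) (i : Fin (suc m)) {v : Fin n} →
                  Missed (ι ∘ punchIn i) v → v ≡ ι i ⊎ Missed ι v
missed-∘punchIn ι i {v} missed with ι i Fin.≟ v
... | yes refl = inj₁ refl
... | no ιi≢v = inj₂ missed-ι
  where
  missed-ι : Missed ι v
  missed-ι j with i Fin.≟ j
  ... | yes refl = ιi≢v
  ... | no i≢j = subst (λ x → ι x ≢ v) (punchIn-punchOut i≢j) (missed (punchOut i≢j))

missed-punchIn : (i : Fin (suc n)) {v : Fin (suc n)} → Missed (punchIn i) v → v ≡ i
missed-punchIn i missed with missed-∘punchIn id i missed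
... | inj₁ v≡i = v≡i
... | inj₂ missed-id = contradiction refl (missed-id _)

isClique-missed-punchIn : (G : Graph (suc n)) (i : Fin (suc n)) → IsClique G (Missed (punchIn i))
isClique-missed-punchIn G i u v mu mv u≢v =
  contradiction (trans (missed-punchIn i mu) (sym (missed-punchIn i mv))) u≢v

isClique-∘punchIn : (G : Graph n) (ι : Fin (suc m) → Fin n) (i : Fin (suc m)) →
                    IsClique G (Missed ι) → (∀ v → Missed ι v → adj G (ι i) v ≡ true) →
                    IsClique G (Missed (ι ∘ punchIn i))
isClique-∘punchIn G ι i clique adjacent u v mu mv u≢v
  with missed-∘punchIn ι i mu | missed-∘punchIn ι i mv
... | inj₁ refl | inj₁ refl = contradiction refl u≢v
... | inj₁ refl | inj₂ mv′  = adjacent v mv′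
... | inj₂ mu′  | inj₁ refl = trans (adj-sym G u (ι i)) (adjacent u mu′)
... | inj₂ mu′  | inj₂ mv′  = clique u v mu′ mv′ u≢v

isClique-missed-edge : (G : Graph (suc (suc n))) (u : Fin (suc (suc n))) (v : Fin (suc n)) →
                       adj G u (punchIn u v) ≡ true → IsClique G (Missed (punchIn u ∘ punchIn v))
isClique-missed-edge G u v uv = isClique-∘punchIn G (punchIn u) v (isClique-missed-punchIn G u) adjacent
  where
  adjacent : ∀ w → Missed (punchIn u) w → adj G (punchIn u v) w ≡ true
  adjacent w missed with missed-punchIn u missed
  ... | refl = trans (adj-sym G _ u) uv

cliqueCover-[] : (G : Graph n) (ι : Fin m → Fin n) → IsClique G (Missed ι) →
                 CliqueCover (G [ ι ]) k → CliqueCover G (suc k)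
cliqueCover-[] {k = k} G ι clique (g , g-covers) =
  (λ v → classOf v (hit? v)) , λ u v → covers u v (hit? u) (hit? v)
  where
  hit? : ∀ v → Dec (∃ λ j → ι j ≡ v)
  hit? v = any? λ j → ι j Fin.≟ v

  classOf : ∀ v → Dec (∃ λ j → ι j ≡ v) → Fin (suc k)
  classOf v (yes (j , _)) = inject₁ (g j)
  classOf v (no _)        = fromℕ k

  covers : ∀ u v du dv → classOf u du ≡ classOf v dv → u ≢ v → adj G u v ≡ true
  covers _ _ (yes (i , refl)) (yes (j , refl)) eq u≢v = g-covers i j (inject₁-injective eq) (u≢v ∘ cong ι)
  covers _ _ (yes (i , _))    (no _)           eq _   = contradiction (sym eq) fromℕ≢inject₁
  covers _ _ (no _)           (yes (j , _))    eq _   = contradiction eq fromℕ≢inject₁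
  covers u v (no ∉u)          (no ∉v)          _  u≢v = clique u v (λ j e → ∉u (j , e)) (λ j e → ∉v (j , e)) u≢v

GapAtLeast : Graph n → ℕ → Set
GapAtLeast G t = ∃ λ g → HasGap G g × t ≤ g

gapAtLeast-transfer : (G : Graph m) (H : Graph n) → HasGap G (suc t) →
                      (∀ {k} → HasStable H k → HasStable G k) →
                      (∀ {k} → CliqueCover H k → CliqueCover G (suc k)) →
                      GapAtLeast H t
gapAtLeast-transfer {t = t} G H (a , c , (_ , α-max) , (_ , θ-min) , c≡) stable→ cover→
  with α-exists H | θ-exists H
... | a′ , αH@(stableH , _) | c′ , θH@(coverH , _) =
  c′ ∸ a′ , (a′ , c′ , αH , θH , sym (m∸n+n≡m (m+n≤o⇒n≤o t t+a′≤c′))) , m+n≤o⇒m≤o∸n t t+a′≤c′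
  where
  open ≤-Reasoning
  t+a′≤c′ : t + a′ ≤ c′
  t+a′≤c′ = ≤-pred (begin
    suc t + a′ ≤⟨ +-monoʳ-≤ (suc t) (α-max a′ (stable→ stableH)) ⟩
    suc t + a  ≡⟨ c≡ ⟨
    c          ≤⟨ θ-min (suc c′) (cover→ coverH) ⟩
    suc c′     ∎)

gapAtLeast-[] : (G : Graph n) (ι : Fin m → Fin n) → HasGap G (suc t) →
                (∀ {k} → HasStable (G [ ι ]) k → HasStable G k) → IsClique G (Missed ι) →
                GapAtLeast (G [ ι ]) t
gapAtLeast-[] G ι gap stable→ clique = gapAtLeast-transfer G (G [ ι ]) gap stable→ (cliqueCover-[] G ι clique)

gapAtLeast-─ : (G : Graph (suc n)) (i : Fin (suc n)) → HasGap G (suc t) → GapAtLeast (G ─ i) t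
gapAtLeast-─ G i gap = gapAtLeast-[] G (punchIn i) gap (hasStable-─ G i) (isClique-missed-punchIn G i)

gapAtLeast⇒inducedGap : (G : Graph n) → GapAtLeast G t →
                        Σ ℕ λ k → k ≤ n × Σ (Fin k → Fin n) λ ι → HasGap (G [ ι ]) t
gapAtLeast⇒inducedGap {n} G (g , gap , t≤g) with m≤n⇒m<n∨m≡n t≤g
... | inj₂ refl = n , ≤-refl , id , gap
gapAtLeast⇒inducedGap {zero} G (suc g , gap , _) | inj₁ (s≤s _) with positiveGap⇒edge G gap
... | () , _
gapAtLeast⇒inducedGap {suc n} G (suc g , gap , _) | inj₁ (s≤s t≤g) with gapAtLeast-─ G zero gap
... | g′ , gap′ , g≤g′ with gapAtLeast⇒inducedGap (G ─ zero) (g′ , gap′ , ≤-trans t≤g g≤g′)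
... | k , k≤n , ι , gapι = k , m≤n⇒m≤1+n k≤n , suc ∘ ι , gapι

GapAfterDeleting : Graph m → ℕ → ℕ → Set
GapAfterDeleting {m} G r t = ∃ λ k → r + k ≡ m × Σ (Fin k → Fin m) λ ι → GapAtLeast (G [ ι ]) t

gapAfterDeleting-edge : (G : Graph (suc m)) (u : Fin (suc m)) (v : Fin m) →
                        adj G u (punchIn u v) ≡ true → HasGap G (suc t) → GapAfterDeleting G 2 t
gapAfterDeleting-edge {suc m} G u v uv gap =
  m , refl , punchIn u ∘ punchIn v ,
  gapAtLeast-[] G _ gap (hasStable-─ G u ∘ hasStable-─ (G ─ u) v) (isClique-missed-edge G u v uv)

gapAfterDeleting-triangle : (G : Graph (suc (suc m))) (u : Fin (suc (suc m))) (v : Fin (suc m)) (w : Fin m) →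
                            adj G u (punchIn u v) ≡ true →
                            adj G u (punchIn u (punchIn v w)) ≡ true →
                            adj G (punchIn u v) (punchIn u (punchIn v w)) ≡ true →
                            HasGap G (suc t) → GapAfterDeleting G 3 t
gapAfterDeleting-triangle {suc m} G u v w uv uw vw gap =
  m , refl , punchIn u ∘ punchIn v ∘ punchIn w ,
  gapAtLeast-[] G _ gap (hasStable-─ G u ∘ hasStable-─ (G ─ u) v ∘ hasStable-─ (G ─ u ─ v) w)
    (isClique-∘punchIn G (punchIn u ∘ punchIn v) w (isClique-missed-edge G u v uv) adjacent)
  where
  adjacent : ∀ x → Missed (punchIn u ∘ punchIn v) x → adj G (punchIn u (punchIn v w)) x ≡ true
  adjacent x missed with missed-∘punchIn (punchIn u) v missed
  ... | inj₁ refl  = trans (adj-sym G _ _) vw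
  ... | inj₂ missed′ with missed-punchIn u missed′
  ...   | refl = trans (adj-sym G _ u) uw

edge⇒gapAfterDeleting : (G : Graph m) {u v : Fin m} → adj G u v ≡ true →
                        HasGap G (suc t) → GapAfterDeleting G 2 t
edge⇒gapAfterDeleting {suc m} G {u} uv =
  gapAfterDeleting-edge G u _ (subst (λ x → adj G u x ≡ true) (sym (punchIn-punchOut (adj⇒≢ G uv))) uv)

triangle⇒gapAfterDeleting : (G : Graph m) {i j k : Fin m} → Triangle G i j k →
                            HasGap G (suc t) → GapAfterDeleting G 3 t
triangle⇒gapAfterDeleting {suc zero} G {zero} {zero} (ij , _) = contradiction refl (adj⇒≢ G ij)
triangle⇒gapAfterDeleting {suc (suc m)} G {i} {j} {k} (ij , jk , ik) =
  gapAfterDeleting-triangle G i j′ (punchOut j′≢k′)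
    (subst (λ x → adj G i x ≡ true) (sym j≡) ij)
    (subst (λ x → adj G i x ≡ true) (sym k≡) ik)
    (subst₂ (λ x y → adj G x y ≡ true) (sym j≡) (sym k≡) jk)
  where
  open ≡-Reasoning
  i≢j : i ≢ j
  i≢j = adj⇒≢ G ij
  i≢k : i ≢ k
  i≢k = adj⇒≢ G ik
  j′ k′ : Fin (suc m)
  j′ = punchOut i≢j
  k′ = punchOut i≢k
  j≡ : punchIn i j′ ≡ j
  j≡ = punchIn-punchOut i≢j
  j′≢k′ : j′ ≢ k′
  j′≢k′ j′≡k′ = adj⇒≢ G jk (begin
    j             ≡⟨ j≡ ⟨
    punchIn i j′  ≡⟨ cong (punchIn i) j′≡k′ ⟩
    punchIn i k′  ≡⟨ punchIn-punchOut i≢k ⟩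
    k             ∎)
  k≡ : punchIn i (punchIn j′ (punchOut j′≢k′)) ≡ k
  k≡ = trans (cong (punchIn i) (punchIn-punchOut j′≢k′)) (punchIn-punchOut i≢k)

IsS-≤ : IsS t s → (G : Graph n) → HasGap G t → s ≤ n
IsS-≤ {n = n} (_ , smaller) G gap = ≮⇒≥ λ n<s → smaller n n<s G gap

IsS₂-≤ : IsS₂ t s → (G : Graph n) → TriangleFree G → HasGap G t → s ≤ n
IsS₂-≤ {n = n} (_ , smaller) G triangleFree gap = ≮⇒≥ λ n<s → smaller n n<s G triangleFree gap

IsS-gapAtLeast : IsS t s → (G : Graph n) → GapAtLeast G t → s ≤ n
IsS-gapAtLeast S G gap≥ with gapAtLeast⇒inducedGap G gap≥
... | _ , k≤n , ι , gap = ≤-trans (IsS-≤ S (G [ ι ]) gap) k≤n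

IsS₂-gapAtLeast : IsS₂ t s → (G : Graph n) → TriangleFree G → GapAtLeast G t → s ≤ n
IsS₂-gapAtLeast S G triangleFree gap≥ with gapAtLeast⇒inducedGap G gap≥
... | _ , k≤n , ι , gap = ≤-trans (IsS₂-≤ S (G [ ι ]) (triangleFree-[] G ι triangleFree) gap) k≤n

≤-gapAfterDeleting : (G : Graph m) → (∀ {k} (ι : Fin k → Fin m) → GapAtLeast (G [ ι ]) t → s ≤ k) →
                     GapAfterDeleting G r t → s + r ≤ m
≤-gapAfterDeleting {s = s} {r = r} G s≤ (k , refl , ι , gap≥) = begin
  s + r ≤⟨ +-monoˡ-≤ r (s≤ ι gap≥) ⟩
  k + r ≡⟨ +-comm k r ⟩
  r + k ∎
  where open ≤-Reasoning

IsS≤IsS₂ : IsS t s → IsS₂ t r → s ≤ r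
IsS≤IsS₂ S ((Q , _ , gap) , _) = IsS-≤ S Q gap

IsS-+2 : IsS t s → (G : Graph m) → HasGap G (suc t) → s + 2 ≤ m
IsS-+2 S G gap with positiveGap⇒edge G gap
... | _ , _ , uv = ≤-gapAfterDeleting G (λ ι → IsS-gapAtLeast S (G [ ι ])) (edge⇒gapAfterDeleting G uv gap)

IsS₂-+2 : IsS₂ t s → (G : Graph m) → TriangleFree G → HasGap G (suc t) → s + 2 ≤ m
IsS₂-+2 S G triangleFree gap with positiveGap⇒edge G gap
... | _ , _ , uv = ≤-gapAfterDeleting G (λ ι → IsS₂-gapAtLeast S (G [ ι ]) (triangleFree-[] G ι triangleFree))
                                       (edge⇒gapAfterDeleting G uv gap)

IsS-+3 : IsS t s → (G : Graph m) {i j k : Fin m} → Triangle G i j k → HasGap G (suc t) → s + 3 ≤ m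
IsS-+3 S G triangle gap =
  ≤-gapAfterDeleting G (λ ι → IsS-gapAtLeast S (G [ ι ])) (triangle⇒gapAfterDeleting G triangle gap)

proposition3p9 : (t s0 s1 r0 r1 : ℕ) →
    IsS t s0 → IsS (suc t) s1 → IsS₂ t r0 → IsS₂ (suc t) r1 →
      (s1 ≡ s0 + 2 → s0 ≡ r0 × s1 ≡ r1)
    × (s0 ≢ r0 ⊎ s1 ≢ r1 → s1 ≥ s0 + 3)
    × (s0 ≡ r0 × s1 ≢ r1 → r1 ≥ r0 + 4)
proposition3p9 t s0 s1 r0 r1 S0 S1@((G , gap) , _) R0 R1 = part1 , part2 , part3
  where
  part1 : s1 ≡ s0 + 2 → s0 ≡ r0 × s1 ≡ r1
  part1 s1≡ with triangle-or-triangleFree G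
  ... | inj₁ (_ , _ , _ , triangle) =
    contradiction (+-cancelˡ-≤ s0 3 2 (subst (s0 + 3 ≤_) s1≡ (IsS-+3 S0 G triangle gap))) λ { (s≤s (s≤s ())) }
  ... | inj₂ triangleFree =
    ≤-antisym (IsS≤IsS₂ S0 R0) (+-cancelʳ-≤ 2 r0 s0 (subst (r0 + 2 ≤_) s1≡ (IsS₂-+2 R0 G triangleFree gap))) ,
    ≤-antisym (IsS≤IsS₂ S1 R1) (IsS₂-≤ R1 G triangleFree gap)

  part2 : s0 ≢ r0 ⊎ s1 ≢ r1 → s1 ≥ s0 + 3
  part2 differs with s1 ≟ℕ s0 + 2
  ... | no s1≢ = subst (_≤ s1) (sym (+-suc s0 2)) (≤∧≢⇒< (IsS-+2 S0 G gap) (s1≢ ∘ sym))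
  ... | yes s1≡ with part1 s1≡ | differs
  ...   | s0≡r0 , _ | inj₁ s0≢r0 = contradiction s0≡r0 s0≢r0
  ...   | _ , s1≡r1 | inj₂ s1≢r1 = contradiction s1≡r1 s1≢r1

  part3 : s0 ≡ r0 × s1 ≢ r1 → r1 ≥ r0 + 4
  part3 (s0≡r0 , s1≢r1) = begin
    r0 + 4       ≡⟨ +-suc r0 3 ⟩
    suc (r0 + 3) ≡⟨ cong (λ x → suc (x + 3)) s0≡r0 ⟨
    suc (s0 + 3) ≤⟨ s≤s (part2 (inj₂ s1≢r1)) ⟩
    suc s1       ≤⟨ ≤∧≢⇒< (IsS≤IsS₂ S1 R1) s1≢r1 ⟩
    r1           ∎
    where open ≤-Reasoning
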